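{- For every $n\geq 1$, $$\sum_{e\in \mathbf{I}_n(\geq,\neq,>)} t^{\mathrm{Asc}(e)}=\sum_{e\in \mathbf{I}_n(>,-,>)} t^{\mathrm{Asc}(e)}.$$
   Context: An inversion sequence of length $n$ is a word $e=e_1e_2\cdots e_n$ of nonnegative integers with $0\leq e_i\leq i-1$ for all $i\in[n]=\{1,\dots,n\}$; $\mathbf{I}_n$ denotes the set of them. For relations $\rho_1,\rho_2,\rho_3\in\{<,>,\leq,\geq,=,\neq,-\}$ (where $-$ is the trivial relation holding for all pairs), $\mathbf{I}_n(\rho_1,\rho_2,\rho_3)$ is the set of $e\in\mathbf{I}_n$ for which there are no indices $1\leq i<j<k\leq n$ with $e_i\,\rho_1\, e_j$, $e_j\,\rho_2\, e_k$ and $e_i\,\rho_3\, e_k$. For a word $w=w_1\cdots w_n$, $\mathrm{Asc}(w)=\{i\in[n-1]: w_i<w_{i+1}\}$, and for a set $S$ of positive integers, $t^{S}$ denotes the monomial $\prod_{i\in S}t_i$ in commuting variables $t_1,t_2,\dots$. -}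

module Defs where

open import Data.Nat using (ℕ; zero; suc; _<ᵇ_; _≡ᵇ_; _≤ᵇ_)
open import Data.Bool using (Bool; true; false; _∧_; not; if_then_else_)
open import Data.Fin using (Fin; toℕ)
open import Data.List using (List; []; _∷_; map; concatMap; filter; allFin; upTo)
open import Data.Bool.ListAction using (any; all)
open import Data.Vec using (Vec; []; _∷_; lookup; toList)
open import Data.Bool using (T)
open import Relation.Nullary.Decidable using (Dec; yes; no)
open import Data.Bool.Properties using (T?)

data Rel : Set where
  lt gt le ge eq ne any' : Rel

holds : Rel → ℕ → ℕ → Bool
holds lt   a b = a <ᵇ b
holds gt   a b = b <ᵇ a
holds le   a b = a ≤ᵇ b
holds ge   a b = b ≤ᵇ a
holds eq   a b = a ≡ᵇ b
holds ne   a b = not (a ≡ᵇ b)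
holds any' a b = true

words : (k m : ℕ) → List (Vec ℕ k)
words zero    m = [] ∷ []
words (suc k) m = concatMap (λ x → map (x ∷_) (words k m)) (upTo m)

-- e is an inversion sequence: e_i ≤ i-1 for all i ∈ [n]
-- (0-based position p = i-1 must satisfy e[p] ≤ p).
isInvSeq : {n : ℕ} → Vec ℕ n → Bool
isInvSeq {n} e = all (λ p → lookup e p ≤ᵇ toℕ p) (allFin n)

-- I_n: all inversion sequences of length n (entries are automatically < n).
I : (n : ℕ) → List (Vec ℕ n)
I n = filter (λ e → T? (isInvSeq e)) (words n n)

contains : {n : ℕ} → Rel → Rel → Rel → Vec ℕ n → Bool
contains {n} r₁ r₂ r₃ e =
  any (λ i → any (λ j → any (λ k →
        (toℕ i <ᵇ toℕ j) ∧ (toℕ j <ᵇ toℕ k)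
        ∧ holds r₁ (lookup e i) (lookup e j)
        ∧ holds r₂ (lookup e j) (lookup e k)
        ∧ holds r₃ (lookup e i) (lookup e k))
      (allFin n)) (allFin n)) (allFin n)

Iavoid : (n : ℕ) → Rel → Rel → Rel → List (Vec ℕ n)
Iavoid n r₁ r₂ r₃ = filter (λ e → T? (not (contains r₁ r₂ r₃ e))) (I n)

-- Ascent set of a word, as the increasing list of 1-based positions i
-- with w_i < w_{i+1}; the argument k is the position of the head.
ascFrom : ℕ → List ℕ → List ℕ
ascFrom k []           = []
ascFrom k (x ∷ [])     = []
ascFrom k (x ∷ y ∷ ws) =
  if x <ᵇ y then k ∷ ascFrom (suc k) (y ∷ ws) else ascFrom (suc k) (y ∷ ws)

Asc : {n : ℕ} → Vec ℕ n → List ℕ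
Asc e = ascFrom 1 (toList e)

-- The generating function  Σ_{e ∈ L} t^{Asc(e)}  as a formal sum of
-- monomials: the multiset (list up to permutation) of monomials t^S,
-- each monomial t^S encoded by its (sorted) exponent set S.
ascGF : {n : ℕ} → List (Vec ℕ n) → List (List ℕ)
ascGF L = map Asc L

-- For a sequence e let M_k be the maximum of e_1 … e_k. The map φ replaces every entry
-- of e ∈ I_n(≥,≠,>) that occurs again later by M_k; the map ψ replaces every entry of
-- e ∈ I_n(>,-,>) that has a weakly larger entry before it and a smaller entry after it
-- by that smaller entry, which is unique because e avoids (>,-,>). If e_k < M_k, avoiding
-- (≥,≠,>) forces every later entry smaller than M_k to equal e_k; this is what makes φ
-- land in I_n(>,-,>), makes ψ undo φ, and keeps every comparison between neighbours, so
-- φ is an Asc-preserving bijection between the two classes.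
module Submission where

open import Defs
open import Data.Nat using (ℕ; zero; suc; _+_; _≤_; _<_; _≥_; z≤n; z<s; s<s; _⊔_; _<ᵇ_)
open import Data.Nat.Properties
open import Data.Bool using (Bool; true; false; T; not; _∧_; if_then_else_)
open import Data.Bool.ListAction using (any)
open import Data.Bool.Properties using (T-∧; T?)
open import Data.Empty using (⊥; ⊥-elim)
open import Data.Unit using (tt)
open import Data.Fin using (Fin; toℕ; fromℕ<) renaming (zero to fzero; suc to fsuc)
open import Data.Fin.Properties using (toℕ<n; toℕ-fromℕ<)
open import Data.Vec using (Vec; []; _∷_; lookup; toList)
import Data.Vec.Properties as Vecₚ
open import Data.List using (List; []; _∷_; _++_; map; concatMap; cartesianProductWith; upTo; allFin)
open import Data.List.Properties using (map-cong-local; map-∘)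
open import Data.List.Membership.Propositional using (_∈_)
open import Data.List.Membership.Propositional.Properties
  using (∈-filter⁻; ∈-filter⁺; ∈-upTo⁺; ∈-cartesianProductWith⁺; ∈-map⁺; ∈-map⁻)
open import Data.List.Membership.Propositional.Properties.WithK using (unique∧set⇒bag)
open import Data.List.Relation.Unary.All using ([])
import Data.List.Relation.Unary.All as All
import Data.List.Relation.Unary.All.Properties as Allₚ
open import Data.List.Relation.Unary.AllPairs using ([]; _∷_)
open import Data.List.Relation.Unary.Any using (here; there; satisfied)
import Data.List.Relation.Unary.Any.Properties as Anyₚ
open import Data.List.Relation.Unary.Unique.Propositional using (Unique)
import Data.List.Relation.Unary.Unique.Propositional.Properties as Uniqueₚ
open import Data.List.Relation.Binary.Permutation.Propositional using (_↭_; module PermutationReasoning)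
import Data.List.Relation.Binary.Permutation.Propositional.Properties as Permₚ
open import Data.List.Relation.Binary.BagAndSetEquality using (∼bag⇒↭)
open import Data.Product using (∃-syntax; _×_; _,_; proj₂)
open import Data.Product.Function.NonDependent.Propositional using (_×-⇔_)
open import Data.Sum using (_⊎_; inj₁; inj₂)
open import Function.Base using (_∘_; id)
open import Function.Bundles using (_⇔_; mk⇔; Equivalence)
import Function.Properties.Equivalence as ⇔
open import Relation.Nullary using (¬_; Dec; yes; no; does; contradiction; _×-dec_)
open import Relation.Nullary.Decidable using (dec-true; dec-false; decidable-stable)
import Relation.Nullary.Decidable as Dec
open import Relation.Binary using (tri<; tri≈; tri>)
open import Relation.Binary.PropositionalEquality

unique-map⁺-injectiveOn : ∀ {A B : Set} (f : A → B) {xs : List A} → Unique xs →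
                          (∀ {x y} → x ∈ xs → y ∈ xs → f x ≡ f y → x ≡ y) → Unique (map f xs)
unique-map⁺-injectiveOn f []          _   = []
unique-map⁺-injectiveOn f (x∉ ∷ uxs) inj =
  Allₚ.map⁺ (All.tabulate λ y∈ fx≡fy → All.lookup x∉ y∈ (inj (here refl) (there y∈) fx≡fy))
  ∷ unique-map⁺-injectiveOn f uxs (λ x∈ y∈ → inj (there x∈) (there y∈))

map-↭-inverseOn : ∀ {A B : Set} {xs : List A} {ys : List B} (f : A → B) (g : B → A) →
                  Unique xs → Unique ys →
                  (∀ {x} → x ∈ xs → f x ∈ ys) → (∀ {y} → y ∈ ys → g y ∈ xs) →
                  (∀ {x} → x ∈ xs → g (f x) ≡ x) → (∀ {y} → y ∈ ys → f (g y) ≡ y) →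
                  map f xs ↭ ys
map-↭-inverseOn {xs = xs} {ys} f g uxs uys f∈ g∈ gf fg =
  ∼bag⇒↭ (unique∧set⇒bag (unique-map⁺-injectiveOn f uxs injective) uys (mk⇔ to from))
  where
  injective : ∀ {x y} → x ∈ xs → y ∈ xs → f x ≡ f y → x ≡ y
  injective x∈ y∈ fx≡fy = trans (sym (gf x∈)) (trans (cong g fx≡fy) (gf y∈))
  to : ∀ {z} → z ∈ map f xs → z ∈ ys
  to z∈ with ∈-map⁻ f z∈
  ... | x , x∈ , refl = f∈ x∈
  from : ∀ {z} → z ∈ ys → z ∈ map f xs
  from z∈ = subst (_∈ map f xs) (fg z∈) (∈-map⁺ f (g∈ z∈))

m<m⊔n⇒m<n : ∀ {m n} → m < m ⊔ n → m < n
m<m⊔n⇒m<n {m} {n} m<m⊔n = ≰⇒> λ n≤m → <-irrefl (sym (m≥n⇒m⊔n≡m n≤m)) m<m⊔n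

prefixMax : (ℕ → ℕ) → ℕ → ℕ
prefixMax s zero    = s zero
prefixMax s (suc k) = prefixMax s k ⊔ s (suc k)

prefixMax-upper : ∀ s {i} k → i ≤ k → s i ≤ prefixMax s k
prefixMax-upper s zero    z≤n = ≤-refl
prefixMax-upper s (suc k) i≤1+k with m≤n⇒m<n∨m≡n i≤1+k
... | inj₁ i<1+k = ≤-trans (prefixMax-upper s k (m<1+n⇒m≤n i<1+k)) (m≤m⊔n _ _)
... | inj₂ refl  = m≤n⊔m _ _

prefixMax-least : ∀ s {c} k → (∀ {i} → i ≤ k → s i ≤ c) → prefixMax s k ≤ c
prefixMax-least s zero    bound = bound z≤n
prefixMax-least s (suc k) bound =
  ⊔-lub (prefixMax-least s k (λ i≤k → bound (m≤n⇒m≤1+n i≤k))) (bound ≤-refl)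

prefixMax-mono : ∀ s {i k} → i ≤ k → prefixMax s i ≤ prefixMax s k
prefixMax-mono s {i} i≤k = prefixMax-least s i (λ j≤i → prefixMax-upper s _ (≤-trans j≤i i≤k))

s≤prefixMax : ∀ s k → s k ≤ prefixMax s k
s≤prefixMax s k = prefixMax-upper s k ≤-refl

prefixMax-attained : ∀ s k →
  ∃[ i ] i ≤ k × s i ≡ prefixMax s k × (∀ {i′} → i′ < i → s i′ < s i)
prefixMax-attained s zero = 0 , z≤n , refl , λ ()
prefixMax-attained s (suc k) with s (suc k) ≤? prefixMax s k | prefixMax-attained s k
... | yes s≤M | i , i≤k , si≡M , leftmost =
  i , m≤n⇒m≤1+n i≤k , trans si≡M (sym (m≥n⇒m⊔n≡m s≤M)) , leftmost
... | no s≰M | _ =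
  suc k , ≤-refl , sym (m≤n⇒m⊔n≡n (<⇒≤ M<s)) ,
  λ i′<1+k → ≤-<-trans (prefixMax-upper s k (m<1+n⇒m≤n i′<1+k)) M<s
  where M<s = ≰⇒> s≰M

prefixMax-attained-before : ∀ s {k} → s k < prefixMax s k → ∃[ i ] i < k × s i ≡ prefixMax s k
prefixMax-attained-before s {k} sk<M with prefixMax-attained s k
... | i , i≤k , si≡M , _ with m≤n⇒m<n∨m≡n i≤k
...   | inj₁ i<k  = i , i<k , si≡M
...   | inj₂ refl = contradiction si≡M (<⇒≢ sk<M)

InvSeq : ℕ → (ℕ → ℕ) → Set
InvSeq n s = ∀ {p} → p < n → s p ≤ p

prefixMax-invSeq : ∀ {n s k} → InvSeq n s → k < n → prefixMax s k ≤ k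
prefixMax-invSeq inv k<n = prefixMax-least _ _ (λ i≤k → ≤-trans (inv (≤-<-trans i≤k k<n)) i≤k)

Avoids≥≠> : ℕ → (ℕ → ℕ) → Set
Avoids≥≠> n s = ∀ {i j k} → i < j → j < k → k < n → s j ≤ s i → s k < s i → s j ≡ s k

Avoids>-> : ℕ → (ℕ → ℕ) → Set
Avoids>-> n s = ∀ {i j k} → i < j → j < k → k < n → s j < s i → s k < s i → ⊥

RepeatedAfter : ℕ → (ℕ → ℕ) → ℕ → Set
RepeatedAfter n s k = ∃[ j ] j < n × k < j × s j ≡ s k

DominatedBefore : (ℕ → ℕ) → ℕ → Set
DominatedBefore s k = ∃[ i ] i < k × s k ≤ s i

SmallerAfter : ℕ → (ℕ → ℕ) → ℕ → Set
SmallerAfter n s k = ∃[ j ] j < n × k < j × s j < s k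

Movable : ℕ → (ℕ → ℕ) → ℕ → Set
Movable n s k = DominatedBefore s k × SmallerAfter n s k

repeatedAfter? : ∀ n s k → Dec (RepeatedAfter n s k)
repeatedAfter? n s k = anyUpTo? (λ j → (k <? j) ×-dec (s j ≟ s k)) n

dominatedBefore? : ∀ s k → Dec (DominatedBefore s k)
dominatedBefore? s k = anyUpTo? (λ i → s k ≤? s i) k

smallerAfter? : ∀ n s k → Dec (SmallerAfter n s k)
smallerAfter? n s k = anyUpTo? (λ j → (k <? j) ×-dec (s j <? s k)) n

φ : ℕ → (ℕ → ℕ) → ℕ → ℕ
φ n s k = if does (repeatedAfter? n s k) then prefixMax s k else s k

ψ : ℕ → (ℕ → ℕ) → ℕ → ℕ
ψ n s k with dominatedBefore? s k | smallerAfter? n s k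
... | yes _ | yes (j , _) = s j
... | _     | _           = s k

module _ {n : ℕ} {s : ℕ → ℕ} where

  φ-repeated : ∀ {k} → RepeatedAfter n s k → φ n s k ≡ prefixMax s k
  φ-repeated {k} r rewrite dec-true (repeatedAfter? n s k) r = refl

  φ-unrepeated : ∀ {k} → ¬ RepeatedAfter n s k → φ n s k ≡ s k
  φ-unrepeated {k} ¬r rewrite dec-false (repeatedAfter? n s k) ¬r = refl

  s≤φ : ∀ k → s k ≤ φ n s k
  s≤φ k with repeatedAfter? n s k
  ... | yes _ = s≤prefixMax s k
  ... | no  _ = ≤-refl

  φ≤prefixMax : ∀ k → φ n s k ≤ prefixMax s k
  φ≤prefixMax k with repeatedAfter? n s k
  ... | yes _ = ≤-refl
  ... | no  _ = s≤prefixMax s k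

  φ-invSeq : InvSeq n s → InvSeq n (φ n s)
  φ-invSeq inv p<n = ≤-trans (φ≤prefixMax _) (prefixMax-invSeq inv p<n)

  φ-fixes-or-raises : ∀ k → φ n s k ≡ s k
                          ⊎ (RepeatedAfter n s k × s k < prefixMax s k × φ n s k ≡ prefixMax s k)
  φ-fixes-or-raises k with repeatedAfter? n s k
  ... | no _ = inj₁ refl
  ... | yes r with s k <? prefixMax s k
  ...   | yes sk<M = inj₂ (r , sk<M , refl)
  ...   | no  sk≮M = inj₁ (≤-antisym (≮⇒≥ sk≮M) (s≤prefixMax s k))

  lastOccurrence : ∀ {j} → j < n → ∃[ j′ ] j ≤ j′ × j′ < n × s j′ ≡ s j × ¬ RepeatedAfter n s j′
  lastOccurrence {j} = go n (m≤n+m n j)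
    where
    go : ∀ fuel {j} → n ≤ j + fuel → j < n →
         ∃[ j′ ] j ≤ j′ × j′ < n × s j′ ≡ s j × ¬ RepeatedAfter n s j′
    go zero {j} n≤j+0 j<n = contradiction (≤-trans n≤j+0 (≤-reflexive (+-identityʳ j))) (<⇒≱ j<n)
    go (suc fuel) {j} n≤j+1+fuel j<n with repeatedAfter? n s j
    ... | no ¬r = j , ≤-refl , j<n , refl , ¬r
    ... | yes (j₂ , j₂<n , j<j₂ , sj₂≡sj)
      with go fuel (≤-trans n≤j+1+fuel (≤-trans (≤-reflexive (+-suc j fuel)) (+-monoˡ-≤ fuel j<j₂))) j₂<n
    ...   | j′ , j₂≤j′ , j′<n , sj′≡sj₂ , ¬r =
            j′ , ≤-trans (<⇒≤ j<j₂) j₂≤j′ , j′<n , trans sj′≡sj₂ sj₂≡sj , ¬r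

  -- The entry where the prefix maximum is attained dominates k, and the last
  -- occurrence of the value s k is left unchanged by φ.
  raised⇒φ-movable : ∀ {k} → RepeatedAfter n s k → s k < prefixMax s k → Movable n (φ n s) k
  raised⇒φ-movable {k} r@(j , j<n , k<j , sj≡sk) sk<M
    with prefixMax-attained-before s sk<M | lastOccurrence j<n
  ... | i , i<k , si≡M | j′ , j≤j′ , j′<n , sj′≡sj , ¬r′ =
    (i , i<k , ≤-trans (≤-reflexive (trans (φ-repeated r) (sym si≡M))) (s≤φ i)) ,
    (j′ , j′<n , <-≤-trans k<j j≤j′ , φj′<φk)
    where
    φj′<φk : φ n s j′ < φ n s k
    φj′<φk = subst₂ _<_ (sym (trans (φ-unrepeated ¬r′) (trans sj′≡sj sj≡sk)))
                        (sym (φ-repeated r)) sk<M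

  φ-unmovable⇒fixed : ∀ {k} → k < n → ¬ Movable n (φ n s) k → φ n s k ≡ s k
  φ-unmovable⇒fixed {k} k<n ¬mv with φ-fixes-or-raises k
  ... | inj₁ φk≡sk          = φk≡sk
  ... | inj₂ (r , sk<M , _) = contradiction (raised⇒φ-movable r sk<M) ¬mv

  module _ (av : Avoids≥≠> n s) where

    repeated-ascent⇒prefixMax< : ∀ {k} → RepeatedAfter n s k → s k < s (suc k) →
                                 prefixMax s k < s (suc k)
    repeated-ascent⇒prefixMax< {k} (j , j<n , k<j , sj≡sk) sk<sk+1 with prefixMax-attained s k
    ... | i , i≤k , si≡M , _ = ≰⇒> sk+1≰M
      where
      sk+1≰M : ¬ s (suc k) ≤ prefixMax s k
      sk+1≰M sk+1≤M with m≤n⇒m<n∨m≡n i≤k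
      ... | inj₂ refl = <⇒≱ sk<sk+1 (≤-trans sk+1≤M (≤-reflexive (sym si≡M)))
      ... | inj₁ i<k = <⇒≢ sk<sk+1 (sym sk+1≡sk)
        where
        sk+1≤si : s (suc k) ≤ s i
        sk+1≤si = ≤-trans sk+1≤M (≤-reflexive (sym si≡M))
        sk+1≡sk : s (suc k) ≡ s k
        sk+1≡sk with suc k ≟ j
        ... | yes refl    = sj≡sk
        ... | no  k+1≢j = trans (av (m<n⇒m<1+n i<k) (≤∧≢⇒< k<j k+1≢j) j<n sk+1≤si
                                    (<-≤-trans (subst (_< s (suc k)) (sym sj≡sk) sk<sk+1) sk+1≤si))
                                sj≡sk

    unrepeated-below-prefixMax⇒ascent : ∀ {k} → ¬ RepeatedAfter n s k → suc k < n →
                                        s k < prefixMax s (suc k) → s k < s (suc k)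
    unrepeated-below-prefixMax⇒ascent {k} ¬r k+1<n sk<M = ≰⇒> sk+1≰sk
      where
      sk+1≰sk : ¬ s (suc k) ≤ s k
      sk+1≰sk sk+1≤sk with prefixMax-attained-before s (≤-<-trans sk+1≤sk sk<M)
      ... | i , i<k+1 , si≡M with m<1+n⇒m<n∨m≡n i<k+1
      ...   | inj₂ refl = <⇒≢ sk<M si≡M
      ...   | inj₁ i<k  = ¬r (suc k , k+1<n , n<1+n k , sym sk≡sk+1)
        where
        sk<si = <-≤-trans sk<M (≤-reflexive (sym si≡M))
        sk≡sk+1 : s k ≡ s (suc k)
        sk≡sk+1 = av i<k (n<1+n k) k+1<n (<⇒≤ sk<si) (≤-<-trans sk+1≤sk sk<si)

    φ-ascent : ∀ {k} → suc k < n → φ n s k < φ n s (suc k) ⇔ s k < s (suc k)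
    φ-ascent {k} k+1<n with repeatedAfter? n s k | repeatedAfter? n s (suc k)
    ... | yes r  | yes _ = mk⇔ (λ M<M⊔ → ≤-<-trans (s≤prefixMax s k) (m<m⊔n⇒m<n M<M⊔))
                               (λ asc → m<n⇒m<o⊔n _ (repeated-ascent⇒prefixMax< r asc))
    ... | yes r  | no  _ = mk⇔ (≤-<-trans (s≤prefixMax s k)) (repeated-ascent⇒prefixMax< r)
    ... | no ¬r  | yes _ = mk⇔ (unrepeated-below-prefixMax⇒ascent ¬r k+1<n)
                               (λ asc → <-≤-trans asc (m≤n⊔m _ _))
    ... | no  _  | no  _ = mk⇔ id id

    φ-avoids>-> : Avoids>-> n (φ n s)
    φ-avoids>-> {i} {j} {k} i<j j<k k<n φj<φi φk<φi with prefixMax-attained s i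
    ... | i₀ , i₀≤i , si₀≡M , _ = <⇒≱ φj<φi φi≤φj
      where
      φi≤si₀ = ≤-trans (φ≤prefixMax i) (≤-reflexive (sym si₀≡M))
      sj≡sk : s j ≡ s k
      sj≡sk = av (≤-<-trans i₀≤i i<j) j<k k<n
                 (<⇒≤ (≤-<-trans (s≤φ j) (<-≤-trans φj<φi φi≤si₀)))
                 (≤-<-trans (s≤φ k) (<-≤-trans φk<φi φi≤si₀))
      φi≤φj : φ n s i ≤ φ n s j
      φi≤φj = begin
        φ n s i         ≤⟨ φ≤prefixMax i ⟩
        prefixMax s i   ≤⟨ prefixMax-mono s (<⇒≤ i<j) ⟩
        prefixMax s j   ≡⟨ φ-repeated (k , k<n , j<k , sym sj≡sk) ⟨
        φ n s j         ∎
        where open ≤-Reasoning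

    φ-fixed⇒unmovable : ∀ {k} → φ n s k ≡ s k → ¬ Movable n (φ n s) k
    φ-fixed⇒unmovable {k} φk≡sk ((i , i<k , φk≤φi) , (j , j<n , k<j , φj<φk))
      with prefixMax-attained s i
    ... | i₀ , i₀≤i , si₀≡M , _ = <-irrefl (sym sk≡sj) sj<sk
      where
      sk≤si₀ : s k ≤ s i₀
      sk≤si₀ = begin
        s k             ≡⟨ φk≡sk ⟨
        φ n s k         ≤⟨ φk≤φi ⟩
        φ n s i         ≤⟨ φ≤prefixMax i ⟩
        prefixMax s i   ≡⟨ si₀≡M ⟨
        s i₀            ∎
        where open ≤-Reasoning
      sj<sk : s j < s k
      sj<sk = ≤-<-trans (s≤φ j) (<-≤-trans φj<φk (≤-reflexive φk≡sk))
      sk≡sj : s k ≡ s j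
      sk≡sj = av (≤-<-trans i₀≤i i<k) k<j j<n sk≤si₀ (<-≤-trans sj<sk sk≤si₀)

    φ-after-raised : ∀ {k j} → s k < prefixMax s k → k < j → j < n →
                     φ n s j < prefixMax s k → φ n s j ≡ s k
    φ-after-raised {k} {j} sk<M k<j j<n φj<M with φ-fixes-or-raises j
    ... | inj₂ (_ , _ , φj≡Mj) =
      contradiction (≤-trans (prefixMax-mono s (<⇒≤ k<j)) (≤-reflexive (sym φj≡Mj))) (<⇒≱ φj<M)
    ... | inj₁ φj≡sj with prefixMax-attained-before s sk<M
    ...   | i₀ , i₀<k , si₀≡M = trans φj≡sj (sym (av i₀<k k<j j<n (<⇒≤ sk<si₀) sj<si₀))
      where
      sk<si₀ = <-≤-trans sk<M (≤-reflexive (sym si₀≡M))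
      sj<si₀ = <-≤-trans (subst (_< prefixMax s k) φj≡sj φj<M) (≤-reflexive (sym si₀≡M))

    φ-movable⇒target : ∀ {k j} → DominatedBefore (φ n s) k → j < n → k < j →
                       φ n s j < φ n s k → φ n s j ≡ s k
    φ-movable⇒target {k} {j} dom j<n k<j φj<φk with φ-fixes-or-raises k
    ... | inj₁ φk≡sk =
      contradiction (dom , j , j<n , k<j , φj<φk) (φ-fixed⇒unmovable φk≡sk)
    ... | inj₂ (_ , sk<M , φk≡M) =
      φ-after-raised sk<M k<j j<n (<-≤-trans φj<φk (≤-reflexive φk≡M))

module _ {n : ℕ} {s : ℕ → ℕ} where

  ψ-cases : ∀ k → (¬ Movable n s k × ψ n s k ≡ s k)
                ⊎ (DominatedBefore s k × ∃[ j ] j < n × k < j × s j < s k × ψ n s k ≡ s j)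
  ψ-cases k with dominatedBefore? s k | smallerAfter? n s k
  ... | yes dom | yes (j , j<n , k<j , sj<sk) = inj₂ (dom , j , j<n , k<j , sj<sk , refl)
  ... | yes _   | no ¬sa = inj₁ ((λ (_ , sa) → ¬sa sa) , refl)
  ... | no ¬dom | _      = inj₁ ((λ (dom , _) → ¬dom dom) , refl)

  ψ≤s : ∀ k → ψ n s k ≤ s k
  ψ≤s k with ψ-cases k
  ... | inj₁ (_ , ψk≡sk)                   = ≤-reflexive ψk≡sk
  ... | inj₂ (_ , _ , _ , _ , sj<sk , ψk≡sj) = ≤-trans (≤-reflexive ψk≡sj) (<⇒≤ sj<sk)

  ψ-invSeq : InvSeq n s → InvSeq n (ψ n s)
  ψ-invSeq inv p<n = ≤-trans (ψ≤s _) (inv p<n)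

  ψ-value-after : ∀ {k} → k < n → ∃[ k* ] k ≤ k* × k* < n × s k* ≡ ψ n s k
  ψ-value-after {k} k<n with ψ-cases k
  ... | inj₁ (_ , ψk≡sk)                        = k , ≤-refl , k<n , sym ψk≡sk
  ... | inj₂ (_ , j , j<n , k<j , _ , ψk≡sj) = j , <⇒≤ k<j , j<n , sym ψk≡sj

  -- The leftmost maximum of a prefix has no weakly larger entry before it,
  -- so ψ leaves it in place.
  prefixMax-ψ : ∀ k → prefixMax (ψ n s) k ≡ prefixMax s k
  prefixMax-ψ k with prefixMax-attained s k
  ... | i₀ , i₀≤k , si₀≡M , leftmost = ≤-antisym
    (prefixMax-least (ψ n s) k (λ {i} i≤k → ≤-trans (ψ≤s i) (prefixMax-upper s k i≤k)))
    (begin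
      prefixMax s k          ≡⟨ si₀≡M ⟨
      s i₀                   ≡⟨ ψ-fixes-leftmost ⟨
      ψ n s i₀               ≤⟨ prefixMax-upper (ψ n s) k i₀≤k ⟩
      prefixMax (ψ n s) k    ∎)
    where
    open ≤-Reasoning
    ψ-fixes-leftmost : ψ n s i₀ ≡ s i₀
    ψ-fixes-leftmost with ψ-cases i₀
    ... | inj₁ (_ , ψi₀≡si₀)             = ψi₀≡si₀
    ... | inj₂ ((i , i<i₀ , si₀≤si) , _) = contradiction (leftmost i<i₀) (≤⇒≯ si₀≤si)

  module _ (av : Avoids>-> n s) where

    smallerAfter-unique : ∀ {k j j′} → k < j → j < n → s j < s k →
                          k < j′ → j′ < n → s j′ < s k → j ≡ j′
    smallerAfter-unique {k} {j} {j′} k<j j<n sj<sk k<j′ j′<n sj′<sk with <-cmp j j′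
    ... | tri< j<j′ _ _ = ⊥-elim (av k<j j<j′ j′<n sj<sk sj′<sk)
    ... | tri≈ _ j≡j′ _ = j≡j′
    ... | tri> _ _ j′<j = ⊥-elim (av k<j′ j′<j j<n sj′<sk sj<sk)

    laterAtMost⇒earlier≤ : ∀ {i k k*} → i < k → k < k* → k* < n → s k* ≤ s k → s i ≤ s k
    laterAtMost⇒earlier≤ i<k k<k* k*<n sk*≤sk =
      ≮⇒≥ λ sk<si → av i<k k<k* k*<n sk<si (≤-<-trans sk*≤sk sk<si)

    ψ-fixes-smallerAfter : ∀ {k j} → k < j → j < n → s j < s k → ψ n s j ≡ s j
    ψ-fixes-smallerAfter {k} {j} k<j j<n sj<sk with ψ-cases j
    ... | inj₁ (_ , ψj≡sj) = ψj≡sj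
    ... | inj₂ (_ , l , l<n , j<l , sl<sj , _) = ⊥-elim (av k<j j<l l<n sj<sk (<-trans sl<sj sj<sk))

    ψ-repeated⇒prefixMax : ∀ {k} → RepeatedAfter n (ψ n s) k → prefixMax (ψ n s) k ≡ s k
    ψ-repeated⇒prefixMax {k} (l , l<n , k<l , ψl≡ψk) = trans (prefixMax-ψ k)
      (≤-antisym (prefixMax-least s k earlier≤) (s≤prefixMax s k))
      where
      later-at-most : ∃[ k* ] k < k* × k* < n × s k* ≤ s k
      later-at-most with ψ-cases k | ψ-value-after l<n
      ... | inj₂ (_ , j , j<n , k<j , sj<sk , _) | _ = j , k<j , j<n , <⇒≤ sj<sk
      ... | inj₁ (_ , ψk≡sk) | k* , l≤k* , k*<n , sk*≡ψl =
        k* , <-≤-trans k<l l≤k* , k*<n , ≤-reflexive (trans sk*≡ψl (trans ψl≡ψk ψk≡sk))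
      earlier≤ : ∀ {i} → i ≤ k → s i ≤ s k
      earlier≤ i≤k with m≤n⇒m<n∨m≡n i≤k | later-at-most
      ... | inj₁ i<k  | k* , k<k* , k*<n , sk*≤sk = laterAtMost⇒earlier≤ i<k k<k* k*<n sk*≤sk
      ... | inj₂ refl | _                         = ≤-refl

    ψ-unrepeated⇒fixed : ∀ {k} → ¬ RepeatedAfter n (ψ n s) k → ψ n s k ≡ s k
    ψ-unrepeated⇒fixed {k} ¬r with ψ-cases k
    ... | inj₁ (_ , ψk≡sk) = ψk≡sk
    ... | inj₂ (_ , j , j<n , k<j , sj<sk , ψk≡sj) =
      contradiction (j , j<n , k<j , trans (ψ-fixes-smallerAfter k<j j<n sj<sk) (sym ψk≡sj)) ¬r

    smallerAfter⇒between≥ : ∀ {i j k*} → i < j → j < k* → k* < n → s k* < s i → s i ≤ s j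
    smallerAfter⇒between≥ i<j j<k* k*<n sk*<si = ≮⇒≥ λ sj<si → av i<j j<k* k*<n sj<si sk*<si

    ψ-moves-onto-smallerAfter : ∀ {i j k*} → i < j → j < k* → k* < n →
                                ψ n s j ≤ s i → s k* < s i → ψ n s j ≡ s k*
    ψ-moves-onto-smallerAfter {i} {j} {k*} i<j j<k* k*<n ψj≤si sk*<si
      with ψ-cases j | <-≤-trans sk*<si (smallerAfter⇒between≥ i<j j<k* k*<n sk*<si)
    ... | inj₁ (¬movable , ψj≡sj) | sk*<sj =
      ⊥-elim (¬movable ((i , i<j , subst (_≤ s i) ψj≡sj ψj≤si) , (k* , k*<n , j<k* , sk*<sj)))
    ... | inj₂ (_ , j₁ , j₁<n , j<j₁ , sj₁<sj , ψj≡sj₁) | sk*<sj =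
      trans ψj≡sj₁ (cong s (smallerAfter-unique j<j₁ j₁<n sj₁<sj j<k* k*<n sk*<sj))

    -- ψ k is the entry of some k* ≥ k, and by uniqueness of smaller later
    -- entries, i cannot be moved while j must be moved onto k*.
    ψ-avoids≥≠> : Avoids≥≠> n (ψ n s)
    ψ-avoids≥≠> {i} {j} {k} i<j j<k k<n ψj≤ψi ψk<ψi with ψ-value-after k<n
    ... | k* , k≤k* , k*<n , sk*≡ψk with ψ-cases i
    ...   | inj₁ (_ , ψi≡si) =
      trans (ψ-moves-onto-smallerAfter i<j (<-≤-trans j<k k≤k*) k*<n
                                       (subst (ψ n s j ≤_) ψi≡si ψj≤ψi)
                                       (subst₂ _<_ (sym sk*≡ψk) ψi≡si ψk<ψi))
            sk*≡ψk
    ...   | inj₂ (_ , j₀ , j₀<n , i<j₀ , sj₀<si , ψi≡sj₀) =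
      ⊥-elim (<-irrefl (cong s (smallerAfter-unique i<k* k*<n sk*<si i<j₀ j₀<n sj₀<si)) sk*<sj₀)
      where
      i<k*    = <-≤-trans (<-trans i<j j<k) k≤k*
      sk*<sj₀ = subst₂ _<_ (sym sk*≡ψk) ψi≡sj₀ ψk<ψi
      sk*<si  = <-trans sk*<sj₀ sj₀<si

EqualBelow : ℕ → (ℕ → ℕ) → (ℕ → ℕ) → Set
EqualBelow n s t = ∀ {k} → k < n → s k ≡ t k

EqualBelow-sym : ∀ {n s t} → EqualBelow n s t → EqualBelow n t s
EqualBelow-sym s≐t k<n = sym (s≐t k<n)

module _ {n : ℕ} {s t : ℕ → ℕ} (s≐t : EqualBelow n s t) where

  private
    ≐₃ : ∀ {i j k} → i < j → j < k → k < n → s i ≡ t i × s j ≡ t j × s k ≡ t k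
    ≐₃ i<j j<k k<n = s≐t (<-trans i<j (<-trans j<k k<n)) , s≐t (<-trans j<k k<n) , s≐t k<n

  invSeq-transport : InvSeq n s → InvSeq n t
  invSeq-transport inv p<n = subst (_≤ _) (s≐t p<n) (inv p<n)

  avoids≥≠>-transport : Avoids≥≠> n s → Avoids≥≠> n t
  avoids≥≠>-transport av i<j j<k k<n tj≤ti tk<ti with ≐₃ i<j j<k k<n
  ... | si≡ti , sj≡tj , sk≡tk =
    subst₂ _≡_ sj≡tj sk≡tk (av i<j j<k k<n (subst₂ _≤_ (sym sj≡tj) (sym si≡ti) tj≤ti)
                                          (subst₂ _<_ (sym sk≡tk) (sym si≡ti) tk<ti))

  avoids>->-transport : Avoids>-> n s → Avoids>-> n t
  avoids>->-transport av i<j j<k k<n tj<ti tk<ti with ≐₃ i<j j<k k<n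
  ... | si≡ti , sj≡tj , sk≡tk = av i<j j<k k<n (subst₂ _<_ (sym sj≡tj) (sym si≡ti) tj<ti)
                                               (subst₂ _<_ (sym sk≡tk) (sym si≡ti) tk<ti)

  repeatedAfter-transport : ∀ {k} → k < n → RepeatedAfter n s k → RepeatedAfter n t k
  repeatedAfter-transport k<n (j , j<n , k<j , sj≡sk) =
    j , j<n , k<j , subst₂ _≡_ (s≐t j<n) (s≐t k<n) sj≡sk

  dominatedBefore-transport : ∀ {k} → k < n → DominatedBefore s k → DominatedBefore t k
  dominatedBefore-transport k<n (i , i<k , sk≤si) =
    i , i<k , subst₂ _≤_ (s≐t k<n) (s≐t (<-trans i<k k<n)) sk≤si

  movable-transport : ∀ {k} → k < n → Movable n s k → Movable n t k
  movable-transport k<n (dom , (j , j<n , k<j , sj<sk)) =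
    dominatedBefore-transport k<n dom , (j , j<n , k<j , subst₂ _<_ (s≐t j<n) (s≐t k<n) sj<sk)

  prefixMax-transport : ∀ {k} → k < n → prefixMax s k ≡ prefixMax t k
  prefixMax-transport {zero}  0<n   = s≐t 0<n
  prefixMax-transport {suc k} k+1<n = cong₂ _⊔_ (prefixMax-transport (<-trans (n<1+n k) k+1<n)) (s≐t k+1<n)

ψ-inverse-of-φ : ∀ {n s t} → Avoids≥≠> n s → EqualBelow n (φ n s) t → EqualBelow n (ψ n t) s
ψ-inverse-of-φ {n} {s} {t} av φs≐t {k} k<n with ψ-cases {n} {t} k
... | inj₁ (¬movable , ψk≡tk) = begin
  ψ n t k   ≡⟨ ψk≡tk ⟩
  t k       ≡⟨ φs≐t k<n ⟨
  φ n s k   ≡⟨ φ-unmovable⇒fixed k<n (λ mv → ¬movable (movable-transport φs≐t k<n mv)) ⟩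
  s k       ∎
  where open ≡-Reasoning
... | inj₂ (dom , j , j<n , k<j , tj<tk , ψk≡tj) = begin
  ψ n t k   ≡⟨ ψk≡tj ⟩
  t j       ≡⟨ t≐φs j<n ⟩
  φ n s j   ≡⟨ φ-movable⇒target av (dominatedBefore-transport t≐φs k<n dom) j<n k<j φj<φk ⟩
  s k       ∎
  where
  open ≡-Reasoning
  t≐φs  = EqualBelow-sym φs≐t
  φj<φk = subst₂ _<_ (t≐φs j<n) (t≐φs k<n) tj<tk

φ-inverse-of-ψ : ∀ {n s t} → Avoids>-> n s → EqualBelow n (ψ n s) t → EqualBelow n (φ n t) s
φ-inverse-of-ψ {n} {s} {t} av ψs≐t {k} k<n with repeatedAfter? n t k
... | yes r = begin
  prefixMax t k         ≡⟨ prefixMax-transport ψs≐t k<n ⟨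
  prefixMax (ψ n s) k   ≡⟨ ψ-repeated⇒prefixMax av (repeatedAfter-transport (EqualBelow-sym ψs≐t) k<n r) ⟩
  s k                   ∎
  where open ≡-Reasoning
... | no ¬r = begin
  t k       ≡⟨ ψs≐t k<n ⟨
  ψ n s k   ≡⟨ ψ-unrepeated⇒fixed av (λ r → ¬r (repeatedAfter-transport ψs≐t k<n r)) ⟩
  s k       ∎
  where open ≡-Reasoning

-- Positions at or beyond the length read as 0; only positions below the
-- length are ever inspected.
entry : ∀ {n} → Vec ℕ n → ℕ → ℕ
entry []      _       = 0
entry (x ∷ _) zero    = x
entry (_ ∷ e) (suc k) = entry e k

tabulateBelow : ∀ n → (ℕ → ℕ) → Vec ℕ n
tabulateBelow zero    f = []
tabulateBelow (suc n) f = f 0 ∷ tabulateBelow n (f ∘ suc)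

entry-tabulateBelow : ∀ n f → EqualBelow n f (entry (tabulateBelow n f))
entry-tabulateBelow (suc n) f {zero}  _         = refl
entry-tabulateBelow (suc n) f {suc k} (s<s k<n) = entry-tabulateBelow n (f ∘ suc) k<n

entry-injective : ∀ {n} {u v : Vec ℕ n} → EqualBelow n (entry u) (entry v) → u ≡ v
entry-injective {u = []}    {[]}    _   = refl
entry-injective {u = x ∷ u} {y ∷ v} u≐v = cong₂ _∷_ (u≐v z<s) (entry-injective (u≐v ∘ s<s))

lookup≡entry : ∀ {n} (e : Vec ℕ n) (p : Fin n) → lookup e p ≡ entry e (toℕ p)
lookup≡entry (x ∷ _) fzero    = refl
lookup≡entry (_ ∷ e) (fsuc p) = lookup≡entry e p

<ᵇ-cong : ∀ {a b c d} → (a < b ⇔ c < d) → (a <ᵇ b) ≡ (c <ᵇ d)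
<ᵇ-cong {a} {b} {c} {d} a<b⇔c<d = Dec.does-≡ (Dec.map a<b⇔c<d (a <? b)) (c <? d)

ascFrom-cong : ∀ {n} (u v : Vec ℕ n) c →
               (∀ {k} → suc k < n → entry u k < entry u (suc k) ⇔ entry v k < entry v (suc k)) →
               ascFrom c (toList u) ≡ ascFrom c (toList v)
ascFrom-cong []           []           c _    = refl
ascFrom-cong (_ ∷ [])     (_ ∷ [])     c _    = refl
ascFrom-cong (x ∷ x′ ∷ u) (y ∷ y′ ∷ v) c same =
  cong₂ (λ b rest → if b then c ∷ rest else rest)
        (<ᵇ-cong (same (s<s z<s)))
        (ascFrom-cong (x′ ∷ u) (y′ ∷ v) (suc c) (same ∘ s<s))

T-not⇒¬T : ∀ {b} → T (not b) → ¬ T b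
T-not⇒¬T {true} () _

¬T⇒T-not : ∀ {b} → ¬ T b → T (not b)
¬T⇒T-not {true}  ¬t = ¬t tt
¬T⇒T-not {false} _  = tt

fromℕ<-entry : ∀ {n} (e : Vec ℕ n) {i} (i<n : i < n) → lookup e (fromℕ< i<n) ≡ entry e i
fromℕ<-entry e i<n = trans (lookup≡entry e _) (cong (entry e) (toℕ-fromℕ< i<n))

isInvSeq⇔ : ∀ {n} (e : Vec ℕ n) → T (isInvSeq e) ⇔ InvSeq n (entry e)
isInvSeq⇔ {n} e = mk⇔ to from
  where
  to : T (isInvSeq e) → InvSeq n (entry e)
  to t {p} p<n = subst₂ _≤_ (fromℕ<-entry e p<n) (toℕ-fromℕ< p<n)
                            (≤ᵇ⇒≤ _ _ (Allₚ.tabulate⁻ (Allₚ.all⁺ _ (allFin n) t) (fromℕ< p<n)))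
  from : InvSeq n (entry e) → T (isInvSeq e)
  from inv = Allₚ.all⁻ _ (Allₚ.tabulate⁺ λ p →
    ≤⇒≤ᵇ (subst (_≤ toℕ p) (sym (lookup≡entry e p)) (inv (toℕ<n p))))

Occurs : ℕ → Rel → Rel → Rel → (ℕ → ℕ) → Set
Occurs n ρ₁ ρ₂ ρ₃ s = ∃[ i ] ∃[ j ] ∃[ k ] i < j × j < k × k < n ×
  T (holds ρ₁ (s i) (s j)) × T (holds ρ₂ (s j) (s k)) × T (holds ρ₃ (s i) (s k))

contains⇔ : ∀ {n} ρ₁ ρ₂ ρ₃ (e : Vec ℕ n) → T (contains ρ₁ ρ₂ ρ₃ e) ⇔ Occurs n ρ₁ ρ₂ ρ₃ (entry e)
contains⇔ {n} ρ₁ ρ₂ ρ₃ e = mk⇔ to from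
  where
  split : ∀ {a b} → T (a ∧ b) → T a × T b
  split = Equivalence.to T-∧
  join : ∀ {a b} → T a → T b → T (a ∧ b)
  join ta tb = Equivalence.from T-∧ (ta , tb)
  holds-entry : ∀ ρ x y → T (holds ρ (lookup e x) (lookup e y)) ≡ T (holds ρ (entry e (toℕ x)) (entry e (toℕ y)))
  holds-entry ρ x y = cong₂ (λ a b → T (holds ρ a b)) (lookup≡entry e x) (lookup≡entry e y)
  to : T (contains ρ₁ ρ₂ ρ₃ e) → Occurs n ρ₁ ρ₂ ρ₃ (entry e)
  to t with satisfied (Anyₚ.any⁻ _ (allFin n) t)
  ... | x , t₁ with satisfied (Anyₚ.any⁻ _ (allFin n) t₁)
  ... | y , t₂ with satisfied (Anyₚ.any⁻ _ (allFin n) t₂)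
  ... | z , t₃ with split t₃
  ... | x<y , t₄ with split t₄
  ... | y<z , t₅ with split t₅
  ... | ρ₁xy , t₆ with split t₆
  ... | ρ₂yz , ρ₃xz =
    toℕ x , toℕ y , toℕ z , <ᵇ⇒< _ _ x<y , <ᵇ⇒< _ _ y<z , toℕ<n z ,
    subst id (holds-entry ρ₁ x y) ρ₁xy , subst id (holds-entry ρ₂ y z) ρ₂yz ,
    subst id (holds-entry ρ₃ x z) ρ₃xz
  from : Occurs n ρ₁ ρ₂ ρ₃ (entry e) → T (contains ρ₁ ρ₂ ρ₃ e)
  from (i , j , k , i<j , j<k , k<n , ρ₁ij , ρ₂jk , ρ₃ik)
    with fromℕ< (<-trans i<j (<-trans j<k k<n)) | toℕ-fromℕ< (<-trans i<j (<-trans j<k k<n))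
       | fromℕ< (<-trans j<k k<n) | toℕ-fromℕ< (<-trans j<k k<n)
       | fromℕ< k<n | toℕ-fromℕ< k<n
  ... | x | refl | y | refl | z | refl =
    found x (found y (found z
      (join (<⇒<ᵇ i<j) (join (<⇒<ᵇ j<k) (join (subst id (sym (holds-entry ρ₁ x y)) ρ₁ij)
        (join (subst id (sym (holds-entry ρ₂ y z)) ρ₂jk) (subst id (sym (holds-entry ρ₃ x z)) ρ₃ik)))))))
    where
    found : ∀ {p : Fin n → Bool} x → T (p x) → T (any p (allFin n))
    found x px = Anyₚ.any⁺ _ (Anyₚ.tabulate⁺ x px)

words-suc : ∀ k m → words (suc k) m ≡ cartesianProductWith _∷_ (upTo m) (words k m)
words-suc k m = prepend-each (upTo m)
  where
  prepend-each : ∀ xs → concatMap (λ x → map (x ∷_) (words k m)) xs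
                      ≡ cartesianProductWith _∷_ xs (words k m)
  prepend-each []       = refl
  prepend-each (x ∷ xs) = cong (map (x ∷_) (words k m) ++_) (prepend-each xs)

words-unique : ∀ k m → Unique (words k m)
words-unique zero    m = [] ∷ []
words-unique (suc k) m = subst Unique (sym (words-suc k m))
  (Uniqueₚ.cartesianProductWith⁺ _∷_ Vecₚ.∷-injective (Uniqueₚ.upTo⁺ m) (words-unique k m))

words-complete : ∀ k m (v : Vec ℕ k) → (∀ {i} → i < k → entry v i < m) → v ∈ words k m
words-complete zero    m []      _       = here refl
words-complete (suc k) m (x ∷ v) bounded = subst (x ∷ v ∈_) (sym (words-suc k m))
  (∈-cartesianProductWith⁺ _∷_ (∈-upTo⁺ (bounded z<s)) (words-complete k m v (bounded ∘ s<s)))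

∈Iavoid⇔ : ∀ {n} ρ₁ ρ₂ ρ₃ {e : Vec ℕ n} →
           e ∈ Iavoid n ρ₁ ρ₂ ρ₃ ⇔ (InvSeq n (entry e) × ¬ Occurs n ρ₁ ρ₂ ρ₃ (entry e))
∈Iavoid⇔ {n} ρ₁ ρ₂ ρ₃ {e} = mk⇔ to from
  where
  to : e ∈ Iavoid n ρ₁ ρ₂ ρ₃ → InvSeq n (entry e) × ¬ Occurs n ρ₁ ρ₂ ρ₃ (entry e)
  to e∈ =
    let e∈I , avoids = ∈-filter⁻ (λ e → T? (not (contains ρ₁ ρ₂ ρ₃ e))) {xs = I n} e∈
        _ , inv = ∈-filter⁻ (λ e → T? (isInvSeq e)) {xs = words n n} e∈I
    in Equivalence.to (isInvSeq⇔ e) inv ,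
       λ occ → T-not⇒¬T avoids (Equivalence.from (contains⇔ ρ₁ ρ₂ ρ₃ e) occ)
  from : InvSeq n (entry e) × ¬ Occurs n ρ₁ ρ₂ ρ₃ (entry e) → e ∈ Iavoid n ρ₁ ρ₂ ρ₃
  from (inv , ¬occ) =
    ∈-filter⁺ (λ e → T? (not (contains ρ₁ ρ₂ ρ₃ e)))
      (∈-filter⁺ (λ e → T? (isInvSeq e))
        (words-complete n n e (λ i<n → ≤-<-trans (inv i<n) i<n))
        (Equivalence.from (isInvSeq⇔ e) inv))
      (¬T⇒T-not (¬occ ∘ Equivalence.to (contains⇔ ρ₁ ρ₂ ρ₃ e)))

Iavoid-unique : ∀ n ρ₁ ρ₂ ρ₃ → Unique (Iavoid n ρ₁ ρ₂ ρ₃)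
Iavoid-unique n ρ₁ ρ₂ ρ₃ = Uniqueₚ.filter⁺ _ (Uniqueₚ.filter⁺ _ (words-unique n n))

¬occurs≥≠>⇔ : ∀ {n s} → (¬ Occurs n ge ne gt s) ⇔ Avoids≥≠> n s
¬occurs≥≠>⇔ {n} {s} = mk⇔ to from
  where
  to : ¬ Occurs n ge ne gt s → Avoids≥≠> n s
  to ¬occ {i} {j} {k} i<j j<k k<n sj≤si sk<si = decidable-stable (s j ≟ s k) λ sj≢sk →
    ¬occ (i , j , k , i<j , j<k , k<n , ≤⇒≤ᵇ sj≤si , ¬T⇒T-not (sj≢sk ∘ ≡ᵇ⇒≡ _ _) , <⇒<ᵇ sk<si)
  from : Avoids≥≠> n s → ¬ Occurs n ge ne gt s
  from av (i , j , k , i<j , j<k , k<n , sj≤si , sj≢sk , sk<si) =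
    T-not⇒¬T sj≢sk (≡⇒≡ᵇ _ _ (av i<j j<k k<n (≤ᵇ⇒≤ _ _ sj≤si) (<ᵇ⇒< _ _ sk<si)))

¬occurs>->⇔ : ∀ {n s} → (¬ Occurs n gt any' gt s) ⇔ Avoids>-> n s
¬occurs>->⇔ {n} {s} = mk⇔ to from
  where
  to : ¬ Occurs n gt any' gt s → Avoids>-> n s
  to ¬occ {i} {j} {k} i<j j<k k<n sj<si sk<si =
    ¬occ (i , j , k , i<j , j<k , k<n , <⇒<ᵇ sj<si , tt , <⇒<ᵇ sk<si)
  from : Avoids>-> n s → ¬ Occurs n gt any' gt s
  from av (i , j , k , i<j , j<k , k<n , sj<si , _ , sk<si) =
    av i<j j<k k<n (<ᵇ⇒< _ _ sj<si) (<ᵇ⇒< _ _ sk<si)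

∈I≥≠>⇔ : ∀ {n} {e : Vec ℕ n} → e ∈ Iavoid n ge ne gt ⇔ (InvSeq n (entry e) × Avoids≥≠> n (entry e))
∈I≥≠>⇔ = ⇔.trans (∈Iavoid⇔ ge ne gt) (⇔.refl ×-⇔ ¬occurs≥≠>⇔)

∈I>->⇔ : ∀ {n} {e : Vec ℕ n} → e ∈ Iavoid n gt any' gt ⇔ (InvSeq n (entry e) × Avoids>-> n (entry e))
∈I>->⇔ = ⇔.trans (∈Iavoid⇔ gt any' gt) (⇔.refl ×-⇔ ¬occurs>->⇔)

φ-vec : ∀ {n} → Vec ℕ n → Vec ℕ n
φ-vec {n} e = tabulateBelow n (φ n (entry e))

ψ-vec : ∀ {n} → Vec ℕ n → Vec ℕ n
ψ-vec {n} e = tabulateBelow n (ψ n (entry e))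

module _ {n : ℕ} where

  φ-vec∈I>-> : ∀ {e : Vec ℕ n} → e ∈ Iavoid n ge ne gt → φ-vec e ∈ Iavoid n gt any' gt
  φ-vec∈I>-> {e} e∈ with Equivalence.to ∈I≥≠>⇔ e∈
  ... | inv , av = Equivalence.from ∈I>->⇔
    (invSeq-transport ≐ (φ-invSeq inv) , avoids>->-transport ≐ (φ-avoids>-> av))
    where ≐ = entry-tabulateBelow n (φ n (entry e))

  ψ-vec∈I≥≠> : ∀ {e : Vec ℕ n} → e ∈ Iavoid n gt any' gt → ψ-vec e ∈ Iavoid n ge ne gt
  ψ-vec∈I≥≠> {e} e∈ with Equivalence.to ∈I>->⇔ e∈
  ... | inv , av = Equivalence.from ∈I≥≠>⇔
    (invSeq-transport ≐ (ψ-invSeq inv) , avoids≥≠>-transport ≐ (ψ-avoids≥≠> av))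
    where ≐ = entry-tabulateBelow n (ψ n (entry e))

  ψ-vec∘φ-vec : ∀ {e : Vec ℕ n} → e ∈ Iavoid n ge ne gt → ψ-vec (φ-vec e) ≡ e
  ψ-vec∘φ-vec {e} e∈ = entry-injective λ k<n →
    trans (sym (entry-tabulateBelow n _ k<n))
          (ψ-inverse-of-φ (proj₂ (Equivalence.to ∈I≥≠>⇔ e∈)) (entry-tabulateBelow n _) k<n)

  φ-vec∘ψ-vec : ∀ {e : Vec ℕ n} → e ∈ Iavoid n gt any' gt → φ-vec (ψ-vec e) ≡ e
  φ-vec∘ψ-vec {e} e∈ = entry-injective λ k<n →
    trans (sym (entry-tabulateBelow n _ k<n))
          (φ-inverse-of-ψ (proj₂ (Equivalence.to ∈I>->⇔ e∈)) (entry-tabulateBelow n _) k<n)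

  Asc-φ-vec : ∀ {e : Vec ℕ n} → e ∈ Iavoid n ge ne gt → Asc (φ-vec e) ≡ Asc e
  Asc-φ-vec {e} e∈ = ascFrom-cong (φ-vec e) e 1 λ {k} k+1<n →
    subst₂ (λ a b → a < b ⇔ entry e k < entry e (suc k))
           (≐ (<-trans (n<1+n k) k+1<n)) (≐ k+1<n)
           (φ-ascent (proj₂ (Equivalence.to ∈I≥≠>⇔ e∈)) k+1<n)
    where ≐ = entry-tabulateBelow n (φ n (entry e))

-- The bijection works equally for n = 0.
theorem1p2 : (n : ℕ) → n ≥ 1 →
    ascGF (Iavoid n ge ne gt) ↭ ascGF (Iavoid n gt any' gt)
theorem1p2 n _ = begin
  map Asc A                 ≡⟨ map-cong-local (All.tabulate (sym ∘ Asc-φ-vec)) ⟩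
  map (Asc ∘ φ-vec) A       ≡⟨ map-∘ A ⟩
  map Asc (map φ-vec A)     ↭⟨ Permₚ.map⁺ Asc φ-vec-bijective ⟩
  map Asc B                 ∎
  where
  open PermutationReasoning
  A = Iavoid n ge ne gt
  B = Iavoid n gt any' gt
  φ-vec-bijective : map φ-vec A ↭ B
  φ-vec-bijective = map-↭-inverseOn φ-vec ψ-vec
    (Iavoid-unique n ge ne gt) (Iavoid-unique n gt any' gt)
    φ-vec∈I>-> ψ-vec∈I≥≠> ψ-vec∘φ-vec φ-vec∘ψ-vec
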